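{- For any positive integers $k_1 > k_2 \geq 2$ and $q > p\geq 1$, we have $A_{k_1}(n;q,p) \geq A_{k_2}(n;q,p)$ for every $n\in \mathbb{N}$.
   Context: For an integer $k\ge 2$ and $N\ge 1$, $K^{(k)}_{[N]}$ denotes the complete $k$-uniform hypergraph on vertex set $[N]$. A tight monotone path of length $n$ in $K^{(k)}_{[N]}$ is a sequence of vertices $v_1<\dots<v_{n+k-1}$ in $[N]$ together with its $n$ edges $\{v_i,\dots,v_{i+k-1}\}$, $i\in[n]$; its color complexity under an edge-colouring is the number of distinct colours on its edges. $A_k(n;q,p)$ is the smallest integer $N$ such that every $q$-colouring of the edges of $K^{(k)}_{[N]}$ contains a tight monotone path of length $n$ with color complexity at most $p$. -}

module Defs where

open import Data.Nat using (ℕ; zero; suc; _+_; _∸_; _≤_; _<_; s≤s)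
open import Data.Nat.Properties using (+-mono-≤; +-suc; ∸-monoˡ-≤; ≤-trans; ≤-reflexive)
open import Data.Fin using (Fin; toℕ; fromℕ<)
import Data.Fin as F
open import Data.Fin.Properties using (toℕ<n; _≟_)
open import Data.Vec using (Vec; tabulate)
open import Data.List using (List; map; allFin; deduplicate; length)
open import Data.Product using (Σ; _×_)
open import Relation.Binary.PropositionalEquality using (sym)

-- Vertex set [N] is represented by Fin N (vertex v ↦ toℕ v + 1).
-- A k-edge of K^(k)_[N] is represented by its increasing enumeration,
-- a vector of k vertices.  A q-colouring of the edges is a map from
-- such vectors to Fin q (its values on non-increasing vectors are never used,
-- so quantifying over these maps is the same as over colourings of k-sets).
Colouring : ℕ → ℕ → ℕ → Set
Colouring k N q = Vec (Fin N) k → Fin q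

idx-bound : ∀ {n k} (i : Fin n) (j : Fin k) → toℕ i + toℕ j < n + k ∸ 1
idx-bound {n} {k} i j =
  ≤-trans (≤-reflexive (sym (+-suc (toℕ i) (toℕ j))))
          (∸-monoˡ-≤ 1 (+-mono-≤ (toℕ<n i) (toℕ<n j)))

idx : ∀ {n k} → Fin n → Fin k → Fin (n + k ∸ 1)
idx i j = fromℕ< (idx-bound i j)

IsMonotone : ∀ {m N} → (Fin m → Fin N) → Set
IsMonotone {m} v = ∀ (i j : Fin m) → i F.< j → v i F.< v j

pathEdge : ∀ {n k N} → (Fin (n + k ∸ 1) → Fin N) → Fin n → Vec (Fin N) k
pathEdge v i = tabulate (λ j → v (idx i j))

colourComplexity : ∀ {n k N q} → Colouring k N q → (Fin (n + k ∸ 1) → Fin N) → ℕ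
colourComplexity {n} c v = length (deduplicate _≟_ (map (λ i → c (pathEdge v i)) (allFin n)))

Arrows : (k n q p N : ℕ) → Set
Arrows k n q p N =
  (c : Colouring k N q) →
  Σ (Fin (n + k ∸ 1) → Fin N) (λ v → IsMonotone v × colourComplexity {n} c v ≤ p)

-- N is the smallest integer N ≥ 1 with the arrow property, i.e. N = A_k(n;q,p).
IsA : (k n q p N : ℕ) → Set
IsA k n q p N = 1 ≤ N × Arrows k n q p N × (∀ M → 1 ≤ M → Arrows k n q p M → N ≤ M)

{-# OPTIONS --safe #-}
module Submission where

open import Defs
open import Data.Nat using (ℕ; suc; _≤_; _<_; _∸_; _+_; _^_; z≤n; s≤s; _≤?_)
open import Data.Nat.Properties using (≮⇒≥; <⇒≤; +-monoʳ-≤; ∸-monoˡ-≤)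
open import Data.Fin as Fin using (Fin; toℕ; fromℕ; fromℕ<; inject≤; finToFun; funToFin)
open import Data.Fin.Properties
  using (any?; all?; _<?_; toℕ-injective; toℕ-fromℕ; toℕ-fromℕ<; toℕ-inject; toℕ-inject≤;
         finToFun-funToFin; ¬∀⟶∃¬-smallest; _≟_)
open import Data.Vec using (Vec; _∷_; tabulate; lookup; truncate)
open import Data.Vec.Properties using (tabulate-cong; tabulate∘lookup)
open import Data.List using (allFin; deduplicate; length; map)
open import Data.List.Properties using (map-cong)
open import Data.Product using (Σ; ∃; _×_; _,_)
open import Function using (_∘_)
open import Level using (0ℓ)
open import Relation.Nullary using (Dec; ¬_)
open import Relation.Nullary.Decidable using (map′; ¬?; decidable-stable; _×-dec_; _→-dec_)
open import Relation.Unary using (Pred; Decidable)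
open import Relation.Binary.PropositionalEquality
  using (_≡_; _≗_; refl; sym; trans; cong; subst; subst₂; module ≡-Reasoning)

-- Colour a k₁-set by the colour of its k₂ smallest elements.  The first n + k₂ − 1 vertices of a
-- tight monotone k₁-path of length n span a tight k₂-path whose i-th edge is the initial segment
-- of the i-th k₁-edge, hence has the same colour; so the arrow property for k₁ at N₁ gives the one
-- for k₂ at N₁.  The least such N, i.e. A_{k₂}(n;q,p), then exists because the arrow property is
-- decidable: colourings and vertex sequences range, up to pointwise equality, over finite sets.

record FinRetract (D : Set) : Set where
  field
    size          : ℕ
    toFin         : D → Fin size
    fromFin       : Fin size → D
    fromFin-toFin : ∀ x → fromFin (toFin x) ≡ x

Fin-retract : ∀ m → FinRetract (Fin m)
Fin-retract m = record { size = m ; toFin = λ i → i ; fromFin = λ i → i ; fromFin-toFin = λ _ → refl }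

Vec-retract : ∀ N k → FinRetract (Vec (Fin N) k)
Vec-retract N k = record
  { size          = N ^ k
  ; toFin         = funToFin ∘ lookup
  ; fromFin       = tabulate ∘ finToFun
  ; fromFin-toFin = λ xs → trans (tabulate-cong (finToFun-funToFin (lookup xs))) (tabulate∘lookup xs)
  }

-- Enumerating functions through funToFin only reaches them up to ≗ (there is no function
-- extensionality), hence the hypothesis resp.
module FunctionSearch {D : Set} (R : FinRetract D) {q : ℕ} {P : Pred (D → Fin q) 0ℓ}
                      (resp : ∀ {f g} → f ≗ g → P f → P g) (P? : Decidable P) where
  open FinRetract R

  enum : Fin (q ^ size) → D → Fin q
  enum i = finToFun i ∘ toFin

  index : (D → Fin q) → Fin (q ^ size)
  index f = funToFin (f ∘ fromFin)

  enum-index : ∀ f → enum (index f) ≗ f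
  enum-index f x = trans (finToFun-funToFin (f ∘ fromFin) (toFin x)) (cong f (fromFin-toFin x))

  anyFun? : Dec (∃ P)
  anyFun? = map′ (λ (i , pᵢ) → enum i , pᵢ)
                 (λ (f , p) → index f , resp (sym ∘ enum-index f) p)
                 (any? (P? ∘ enum))

  allFun? : Dec (∀ f → P f)
  allFun? = map′ (λ all f → resp (enum-index f) (all (index f)))
                 (λ all i → all (enum i))
                 (all? (P? ∘ enum))

open FunctionSearch using (anyFun?; allFun?)

∃-least : ∀ {Q : Pred ℕ 0ℓ} {n} → Decidable Q → Q n → ∃ λ m → Q m × (∀ m′ → Q m′ → m ≤ m′)
∃-least {Q} {n} Q? qₙ with ¬∀⟶∃¬-smallest (suc n) (¬_ ∘ Q ∘ toℕ) (¬? ∘ Q? ∘ toℕ) ¬all-¬Q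
  where
  ¬all-¬Q : ¬ (∀ i → ¬ Q (toℕ i))
  ¬all-¬Q all = all (fromℕ n) (subst Q (sym (toℕ-fromℕ n)) qₙ)
... | i , ¬¬qᵢ , below = toℕ i , decidable-stable (Q? (toℕ i)) ¬¬qᵢ , minimal
  where
  minimal : ∀ m′ → Q m′ → toℕ i ≤ m′
  minimal m′ q′ = ≮⇒≥ λ m′<i →
    below (fromℕ< m′<i) (subst Q (sym (trans (toℕ-inject (fromℕ< m′<i)) (toℕ-fromℕ< m′<i))) q′)

IsMonotone? : ∀ {m N} (v : Fin m → Fin N) → Dec (IsMonotone v)
IsMonotone? v = all? λ i → all? λ j → (i <? j) →-dec (v i <? v j)

IsMonotone-≗ : ∀ {m N} {v w : Fin m → Fin N} → v ≗ w → IsMonotone v → IsMonotone w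
IsMonotone-≗ v≗w mono i j i<j = subst₂ Fin._<_ (v≗w i) (v≗w j) (mono i j i<j)

IsMonotone-∘inject≤ : ∀ {m m′ N} {v : Fin m′ → Fin N} (m≤m′ : m ≤ m′) →
                      IsMonotone v → IsMonotone (λ x → v (inject≤ x m≤m′))
IsMonotone-∘inject≤ m≤m′ mono i j i<j =
  mono _ _ (subst₂ _<_ (sym (toℕ-inject≤ i m≤m′)) (sym (toℕ-inject≤ j m≤m′)) i<j)

colourComplexity-cong : ∀ {k k′ N q} n (c : Colouring k N q) (v : Fin (n + k ∸ 1) → Fin N)
                          (c′ : Colouring k′ N q) (v′ : Fin (n + k′ ∸ 1) → Fin N) →
                        (∀ i → c (pathEdge {n} v i) ≡ c′ (pathEdge {n} v′ i)) →
                        colourComplexity {n} c v ≡ colourComplexity {n} c′ v′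
colourComplexity-cong n _ _ _ _ same = cong (length ∘ deduplicate _≟_) (map-cong same (allFin n))

FewColouredPath : ∀ {k N q} n → ℕ → Colouring k N q → (Fin (n + k ∸ 1) → Fin N) → Set
FewColouredPath n p c v = IsMonotone v × colourComplexity {n} c v ≤ p

Arrows? : ∀ k n q p N → Dec (Arrows k n q p N)
Arrows? k n q p N = allFun? (Vec-retract N k) resp-c λ c →
  anyFun? (Fin-retract (n + k ∸ 1)) (resp-v c) λ v → IsMonotone? v ×-dec (colourComplexity {n} c v ≤? p)
  where
  resp-v : ∀ c {v w} → v ≗ w → FewColouredPath n p c v → FewColouredPath n p c w
  resp-v c {v} {w} v≗w (mono , few) =
    IsMonotone-≗ v≗w mono ,
    subst (_≤ p) (colourComplexity-cong n c v c w λ i → cong c (tabulate-cong (v≗w ∘ idx i))) few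
  resp-c : ∀ {c c′} → c ≗ c′ → ∃ (FewColouredPath n p c) → ∃ (FewColouredPath n p c′)
  resp-c {c} {c′} c≗c′ (v , mono , few) =
    v , mono , subst (_≤ p) (colourComplexity-cong n c v c′ v (c≗c′ ∘ pathEdge v)) few

truncate-tabulate : ∀ {A : Set} {m m′} (m≤m′ : m ≤ m′) (f : Fin m′ → A) →
                    truncate m≤m′ (tabulate f) ≡ tabulate (λ j → f (inject≤ j m≤m′))
truncate-tabulate z≤n       f = refl
truncate-tabulate (s≤s m≤m′) f = cong (f Fin.zero ∷_) (truncate-tabulate m≤m′ (f ∘ Fin.suc))

module _ {n k₁ k₂ : ℕ} (k₂≤k₁ : k₂ ≤ k₁) where

  vertices-≤ : n + k₂ ∸ 1 ≤ n + k₁ ∸ 1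
  vertices-≤ = ∸-monoˡ-≤ 1 (+-monoʳ-≤ n k₂≤k₁)

  idx-inject≤ : ∀ (i : Fin n) (j : Fin k₂) → idx i (inject≤ j k₂≤k₁) ≡ inject≤ (idx i j) vertices-≤
  idx-inject≤ i j = toℕ-injective (begin
    toℕ (idx i (inject≤ j k₂≤k₁))    ≡⟨ toℕ-fromℕ< _ ⟩
    toℕ i + toℕ (inject≤ j k₂≤k₁)    ≡⟨ cong (toℕ i +_) (toℕ-inject≤ j k₂≤k₁) ⟩
    toℕ i + toℕ j                    ≡⟨ toℕ-fromℕ< _ ⟨
    toℕ (idx i j)                    ≡⟨ toℕ-inject≤ (idx i j) vertices-≤ ⟨
    toℕ (inject≤ (idx i j) vertices-≤) ∎)
    where open ≡-Reasoning

  pathEdge-truncate : ∀ {N} (v : Fin (n + k₁ ∸ 1) → Fin N) (i : Fin n) →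
                      truncate k₂≤k₁ (pathEdge {n} v i) ≡ pathEdge {n} (λ x → v (inject≤ x vertices-≤)) i
  pathEdge-truncate v i =
    trans (truncate-tabulate k₂≤k₁ (v ∘ idx i)) (tabulate-cong (cong v ∘ idx-inject≤ i))

  Arrows-antitone-uniformity : ∀ {q p N} → Arrows k₁ n q p N → Arrows k₂ n q p N
  Arrows-antitone-uniformity {p = p} arrows c with arrows (c ∘ truncate k₂≤k₁)
  ... | v , mono , few = initial , IsMonotone-∘inject≤ vertices-≤ mono , subst (_≤ p) same-complexity few
    where
    initial : Fin (n + k₂ ∸ 1) → Fin _
    initial x = v (inject≤ x vertices-≤)
    same-complexity : colourComplexity {n} (c ∘ truncate k₂≤k₁) v ≡ colourComplexity {n} c initial
    same-complexity = colourComplexity-cong n (c ∘ truncate k₂≤k₁) v c initial (cong c ∘ pathEdge-truncate v)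

lemma4p2 : ∀ (k₁ k₂ q p n : ℕ) → 2 ≤ k₂ → k₂ < k₁ → 1 ≤ p → p < q →
    ∀ N₁ → IsA k₁ n q p N₁ → Σ ℕ (λ N₂ → IsA k₂ n q p N₂ × N₂ ≤ N₁)
lemma4p2 k₁ k₂ q p n _ k₂<k₁ _ _ N₁ (1≤N₁ , arrows₁ , _) =
  let N₂ , (1≤N₂ , arrows-N₂) , least = ∃-least (λ m → (1 ≤? m) ×-dec Arrows? k₂ n q p m) (1≤N₁ , arrows₂)
  in N₂ , (1≤N₂ , arrows-N₂ , λ M 1≤M arrows-M → least M (1≤M , arrows-M)) , least N₁ (1≤N₁ , arrows₂)
  where
  arrows₂ : Arrows k₂ n q p N₁
  arrows₂ = Arrows-antitone-uniformity {n} (<⇒≤ k₂<k₁) arrows₁
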